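{- For every integer $n\ge 0$, the following identity of rational functions in the indeterminates $q$, $x$, $t$ holds: \[ \sum_{i=0}^n\begin{bmatrix} n\\ i\end{bmatrix}_q(-1)^{i-1}(x+1)(x+q)\cdots(x+q^{i-1})\frac{q^i}{1-tq^i} =-\frac{(q;q)_n}{(t;q)_{n+1}}\sum_{i=0}^n\frac{(t;q)_{i}}{(q;q)_i}(-xq)^i . \]
   Context: Notation: $(a;q)_k=(1-a)(1-aq)\cdots(1-aq^{k-1})$ (with $(a;q)_0=1$), and the $q$-binomial coefficient is $\begin{bmatrix} n\\ k\end{bmatrix}_q=\frac{(q;q)_n}{(q;q)_k(q;q)_{n-k}}$. The product $(x+1)(x+q)\cdots(x+q^{i-1})$ has $i$ factors and equals $1$ for $i=0$. -}

module Defs where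

open import Level using (Level)
open import Data.Nat using (ℕ; zero; suc; _∸_)
open import Algebra.Bundles using (CommutativeRing)

module QNotation {c ℓ : Level} (R : CommutativeRing c ℓ) where
  open CommutativeRing R

  pow : Carrier → ℕ → Carrier
  pow a zero    = 1#
  pow a (suc k) = a * pow a k

  sumTo : ℕ → (ℕ → Carrier) → Carrier
  sumTo zero    f = f 0
  sumTo (suc n) f = sumTo n f + f (suc n)

  qPoch : Carrier → Carrier → ℕ → Carrier
  qPoch a q zero    = 1#
  qPoch a q (suc k) = qPoch a q k * (1# + - (a * pow q k))

  riseProd : Carrier → Carrier → ℕ → Carrier
  riseProd x q zero    = 1#
  riseProd x q (suc i) = riseProd x q i * (x + pow q i)

  -- q-binomial [n k]_q = (q;q)_n / ((q;q)_k (q;q)_{n-k}),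
  -- where invQ j is the inverse of (q;q)_j
  qBinom : (ℕ → Carrier) → Carrier → ℕ → ℕ → Carrier
  qBinom invQ q n k = qPoch q q n * (invQ k * invQ (n ∸ k))

-- Let L_m be the left-hand side with n replaced by m.  Writing
-- 1 - t q^m = (1 - q^(m-i)) + q^(m-i) (1 - t q^i) in the i-th summand and using
-- [m i] (1 - q^(m-i)) = (1 - q^m) [m-1 i] gives the recurrence
--   (1 - t q^m) L_m = (1 - q^m) L_(m-1) - q^m Σ_i [m i] (-1)^i (x+1)⋯(x+q^(i-1)),
-- and by q-Pascal the last sum is (-x)^m.  Induction on m then yields
--   (t;q)_(m+1) L_m = -(q;q)_m Σ_(i≤m) (t;q)_i/(q;q)_i (-xq)^i.

module Submission where

open import Defs
open import Level using (Level)
open import Algebra.Bundles using (CommutativeRing; RawRing)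
open import Data.Maybe using (map)
open import Data.Nat as ℕ using (ℕ; zero; suc; _≤_; _<_; _∸_; z≤n; s≤s)
open import Data.Nat.Properties using (≤-refl; ≤-trans; <⇒≤; m≤n⇒m≤1+n; m∸n≤m; n∸n≡0; +-∸-assoc; +-suc; m+[n∸m]≡n)
open import Data.Product using (_×_; _,_)
open import Data.Product.Properties using (≡-dec)
open import Function using (_∘_)
open import Relation.Binary.Consequences using (dec⇒weaklyDec)
open import Relation.Binary.PropositionalEquality as ≡ using (_≡_)
open import Algebra.Solver.Ring.AlmostCommutativeRing using (fromCommutativeRing; _-Raw-AlmostCommutative⟶_)

-- Coefficients in ℤ let the solver prove identities that need cancellation
-- (u - u = 0) in an arbitrary commutative ring.
module IntegerCoefficientSolver {c ℓ : Level} (R : CommutativeRing c ℓ) where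
  open CommutativeRing R hiding (zero)
  open import Algebra.Properties.Ring ring using (-0#≈0#; -‿+-comm; -‿distribˡ-*; -‿distribʳ-*; -‿involutive; ⁻¹-anti-homo‿-)
  open import Algebra.Properties.CommutativeSemigroup +-commutativeSemigroup using (interchange)
  open import Algebra.Properties.Semiring.Mult.TCOptimised semiring
    using (1+×; ×-homo-+; ×1-homo-*) renaming (_×_ to _·_)
  open import Algebra.Solver.Ring.NaturalCoefficients.Default commutativeSemiring
    using () renaming (solve to semiring-solve; _:+_ to _⊕_; _:*_ to _⊗_; _:=_ to _⊜_)
  open import Relation.Binary.Reasoning.Setoid setoid

  -- The pair (a , b) stands for a - b.  Operations keep one component zero so
  -- that equal integers are represented identically, and ⟦ 1 , 0 ⟧ is 1# itself:
  -- solved equations are then checked by refl and match goals definitionally.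
  normalise : ℕ → ℕ → ℕ × ℕ
  normalise (suc a) (suc b) = normalise a b
  normalise a       b       = a , b

  ℤ-rawRing : RawRing _ _
  ℤ-rawRing = record
    { Carrier = ℕ × ℕ
    ; _≈_     = _≡_
    ; _+_     = λ { (a , b) (c , d) → normalise (a ℕ.+ c) (b ℕ.+ d) }
    ; _*_     = λ { (a , b) (c , d) → normalise (a ℕ.* c ℕ.+ b ℕ.* d) (a ℕ.* d ℕ.+ b ℕ.* c) }
    ; -_      = λ { (a , b) → b , a }
    ; 0#      = 0 , 0
    ; 1#      = 1 , 0
    }

  ⟦_⟧ : ℕ × ℕ → Carrier
  ⟦ a , zero  ⟧ = a · 1#
  ⟦ a , suc b ⟧ = a · 1# - suc b · 1#

  ⟦⟧-difference : ∀ a b → ⟦ a , b ⟧ ≈ a · 1# - b · 1#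
  ⟦⟧-difference a zero    = sym (trans (+-congˡ -0#≈0#) (+-identityʳ _))
  ⟦⟧-difference a (suc b) = refl

  +-cancelˡ-difference : ∀ u v w → (w + u) - (w + v) ≈ u - v
  +-cancelˡ-difference u v w = begin
    (w + u) - (w + v)       ≈⟨ +-congˡ (-‿+-comm w v) ⟨
    (w + u) + (- w + - v)   ≈⟨ interchange w u (- w) (- v) ⟩
    (w - w) + (u - v)       ≈⟨ +-congʳ (-‿inverseʳ w) ⟩
    0# + (u - v)            ≈⟨ +-identityˡ _ ⟩
    u - v                   ∎

  normalise-correct : ∀ a b → ⟦ normalise a b ⟧ ≈ a · 1# - b · 1#
  normalise-correct zero    b       = ⟦⟧-difference zero b
  normalise-correct (suc a) zero    = ⟦⟧-difference (suc a) zero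
  normalise-correct (suc a) (suc b) = begin
    ⟦ normalise a b ⟧                 ≈⟨ normalise-correct a b ⟩
    a · 1# - b · 1#                   ≈⟨ +-cancelˡ-difference _ _ 1# ⟨
    (1# + a · 1#) - (1# + b · 1#)     ≈⟨ +-cong (1+× a 1#) (-‿cong (1+× b 1#)) ⟨
    suc a · 1# - suc b · 1#           ∎

  +-difference : ∀ u v w z → (u + w) - (v + z) ≈ (u - v) + (w - z)
  +-difference u v w z = begin
    (u + w) - (v + z)       ≈⟨ +-congˡ (-‿+-comm v z) ⟨
    (u + w) + (- v + - z)   ≈⟨ interchange u w (- v) (- z) ⟩
    (u - v) + (w - z)       ∎

  *-difference : ∀ u v w z → (u * w + v * z) - (u * z + v * w) ≈ (u - v) * (w - z)
  *-difference u v w z = sym (begin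
    (u + - v) * (w + - z)
      ≈⟨ semiring-solve 4 (λ u v w z → (u ⊕ v) ⊗ (w ⊕ z) ⊜ (u ⊗ w ⊕ v ⊗ z) ⊕ (u ⊗ z ⊕ v ⊗ w))
           refl u (- v) w (- z) ⟩
    (u * w + - v * - z) + (u * - z + - v * w)
      ≈⟨ +-cong (+-congˡ minus-minus) (+-cong (sym (-‿distribʳ-* u z)) (sym (-‿distribˡ-* v w))) ⟩
    (u * w + v * z) + (- (u * z) + - (v * w))
      ≈⟨ +-congˡ (-‿+-comm _ _) ⟩
    (u * w + v * z) - (u * z + v * w) ∎)
    where
    minus-minus : - v * - z ≈ v * z
    minus-minus = trans (sym (-‿distribˡ-* v (- z)))
                        (trans (-‿cong (sym (-‿distribʳ-* v z))) (-‿involutive _))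

  homomorphism : ℤ-rawRing -Raw-AlmostCommutative⟶ fromCommutativeRing R
  homomorphism = record
    { ⟦_⟧    = ⟦_⟧
    ; +-homo = λ { (a , b) (c , d) → begin
        ⟦ normalise (a ℕ.+ c) (b ℕ.+ d) ⟧           ≈⟨ normalise-correct (a ℕ.+ c) (b ℕ.+ d) ⟩
        (a ℕ.+ c) · 1# - (b ℕ.+ d) · 1#             ≈⟨ +-cong (×-homo-+ 1# a c) (-‿cong (×-homo-+ 1# b d)) ⟩
        (a · 1# + c · 1#) - (b · 1# + d · 1#)       ≈⟨ +-difference _ _ _ _ ⟩
        (a · 1# - b · 1#) + (c · 1# - d · 1#)       ≈⟨ +-cong (⟦⟧-difference a b) (⟦⟧-difference c d) ⟨
        ⟦ a , b ⟧ + ⟦ c , d ⟧                       ∎ }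
    ; *-homo = λ { (a , b) (c , d) → begin
        ⟦ normalise (a ℕ.* c ℕ.+ b ℕ.* d) (a ℕ.* d ℕ.+ b ℕ.* c) ⟧    ≈⟨ normalise-correct (a ℕ.* c ℕ.+ b ℕ.* d) (a ℕ.* d ℕ.+ b ℕ.* c) ⟩
        (a ℕ.* c ℕ.+ b ℕ.* d) · 1# - (a ℕ.* d ℕ.+ b ℕ.* c) · 1#
          ≈⟨ +-cong (trans (×-homo-+ 1# (a ℕ.* c) (b ℕ.* d)) (+-cong (×1-homo-* a c) (×1-homo-* b d)))
                    (-‿cong (trans (×-homo-+ 1# (a ℕ.* d) (b ℕ.* c)) (+-cong (×1-homo-* a d) (×1-homo-* b c)))) ⟩
        (a · 1# * c · 1# + b · 1# * d · 1#) - (a · 1# * d · 1# + b · 1# * c · 1#)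
          ≈⟨ *-difference _ _ _ _ ⟩
        (a · 1# - b · 1#) * (c · 1# - d · 1#)
          ≈⟨ *-cong (⟦⟧-difference a b) (⟦⟧-difference c d) ⟨
        ⟦ a , b ⟧ * ⟦ c , d ⟧                                        ∎ }
    ; -‿homo = λ { (a , b) → begin
        ⟦ b , a ⟧              ≈⟨ ⟦⟧-difference b a ⟩
        b · 1# - a · 1#        ≈⟨ ⁻¹-anti-homo‿- _ _ ⟨
        - (a · 1# - b · 1#)    ≈⟨ -‿cong (⟦⟧-difference a b) ⟨
        - ⟦ a , b ⟧            ∎ }
    ; 0-homo = refl
    ; 1-homo = refl
    }

  open import Algebra.Solver.Ring ℤ-rawRing (fromCommutativeRing R) homomorphism
    (λ x y → map (reflexive ∘ ≡.cong ⟦_⟧) (dec⇒weaklyDec (≡-dec ℕ._≟_ ℕ._≟_) x y))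
    using (solve; con; Polynomial; _:+_; _:*_; :-_; _:-_; _:=_) public

  one : ∀ {k} → Polynomial k
  one = con (1 , 0)

module QSeries {r ℓ : Level} (R : CommutativeRing r ℓ) where
  open CommutativeRing R hiding (zero)
  open QNotation R
  open IntegerCoefficientSolver R
  open import Relation.Binary.Reasoning.Setoid setoid

  sumTo-cong : ∀ m {f g : ℕ → Carrier} → (∀ i → i ≤ m → f i ≈ g i) → sumTo m f ≈ sumTo m g
  sumTo-cong zero    f≈g = f≈g 0 z≤n
  sumTo-cong (suc m) f≈g =
    +-cong (sumTo-cong m (λ i i≤m → f≈g i (m≤n⇒m≤1+n i≤m))) (f≈g (suc m) ≤-refl)

  sumTo-linear : ∀ m a b (f g : ℕ → Carrier) →
    sumTo m (λ i → a * f i + b * g i) ≈ a * sumTo m f + b * sumTo m g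
  sumTo-linear zero    a b f g = refl
  sumTo-linear (suc m) a b f g = trans (+-congʳ (sumTo-linear m a b f g))
    (solve 6 (λ a b S T u v → (a :* S :+ b :* T) :+ (a :* u :+ b :* v) := a :* (S :+ u) :+ b :* (T :+ v))
       refl a b (sumTo m f) (sumTo m g) (f (suc m)) (g (suc m)))

  *-distribˡ-sumTo : ∀ m a (f : ℕ → Carrier) → a * sumTo m f ≈ sumTo m (λ i → a * f i)
  *-distribˡ-sumTo zero    a f = refl
  *-distribˡ-sumTo (suc m) a f = trans (distribˡ a (sumTo m f) (f (suc m))) (+-congʳ (*-distribˡ-sumTo m a f))

  sumTo-pascal : ∀ m {f g h : ℕ → Carrier} → f 0 ≈ h 0 →
    (∀ i → i < m → f (suc i) ≈ g i + h (suc i)) → f (suc m) ≈ g m →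
    sumTo (suc m) f ≈ sumTo m (λ i → g i + h i)
  sumTo-pascal m {f} {g} {h} f₀ f-step f-last = trans (+-congˡ f-last) (partial m ≤-refl)
    where
    partial : ∀ k → k ≤ m → sumTo k f + g k ≈ sumTo k (λ i → g i + h i)
    partial zero    _   = trans (+-congʳ f₀) (+-comm (h 0) (g 0))
    partial (suc k) k<m = begin
      (sumTo k f + f (suc k)) + g (suc k)            ≈⟨ +-congʳ (+-congˡ (f-step k k<m)) ⟩
      (sumTo k f + (g k + h (suc k))) + g (suc k)
        ≈⟨ solve 4 (λ s a b c → (s :+ (a :+ b)) :+ c := (s :+ a) :+ (c :+ b)) refl _ _ _ _ ⟩
      (sumTo k f + g k) + (g (suc k) + h (suc k))    ≈⟨ +-congʳ (partial k (<⇒≤ k<m)) ⟩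
      sumTo (suc k) (λ i → g i + h i)                ∎

  *-inverse-unique : ∀ {a b b′} → a * b ≈ 1# → a * b′ ≈ 1# → b ≈ b′
  *-inverse-unique {a} {b} {b′} ab≈1 ab′≈1 = begin
    b              ≈⟨ *-identityʳ b ⟨
    b * 1#         ≈⟨ *-congˡ ab′≈1 ⟨
    b * (a * b′)   ≈⟨ solve 3 (λ a b b′ → b :* (a :* b′) := (a :* b) :* b′) refl a b b′ ⟩
    (a * b) * b′   ≈⟨ *-congʳ ab≈1 ⟩
    1# * b′        ≈⟨ *-identityˡ b′ ⟩
    b′             ∎

  *-inverse-solve : ∀ {a a⁻¹ b c} → a * a⁻¹ ≈ 1# → a * b ≈ c → b ≈ a⁻¹ * c
  *-inverse-solve {a} {a⁻¹} {b} {c} aa⁻¹≈1 ab≈c = begin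
    b                ≈⟨ *-identityˡ b ⟨
    1# * b           ≈⟨ *-congʳ aa⁻¹≈1 ⟨
    (a * a⁻¹) * b    ≈⟨ solve 3 (λ a a⁻¹ b → (a :* a⁻¹) :* b := a⁻¹ :* (a :* b)) refl a a⁻¹ b ⟩
    a⁻¹ * (a * b)    ≈⟨ *-congˡ ab≈c ⟩
    a⁻¹ * c          ∎

  pow-cong : ∀ {a b} m → a ≈ b → pow a m ≈ pow b m
  pow-cong zero    a≈b = refl
  pow-cong (suc m) a≈b = *-cong a≈b (pow-cong m a≈b)

  pow-+ : ∀ a i j → pow a (i ℕ.+ j) ≈ pow a i * pow a j
  pow-+ a zero    j = sym (*-identityˡ _)
  pow-+ a (suc i) j = trans (*-congˡ (pow-+ a i j)) (sym (*-assoc a (pow a i) (pow a j)))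

  pow-distrib-* : ∀ a b m → pow (a * b) m ≈ pow a m * pow b m
  pow-distrib-* a b zero    = sym (*-identityˡ 1#)
  pow-distrib-* a b (suc m) = trans (*-congˡ (pow-distrib-* a b m))
    (solve 4 (λ a b u v → (a :* b) :* (u :* v) := (a :* u) :* (b :* v)) refl a b (pow a m) (pow b m))

  pow-split : ∀ a {i k} → i ≤ k → pow a (suc k) ≈ pow a i * pow a (suc (k ∸ i))
  pow-split a {i} {k} i≤k = begin
    pow a (suc k)                  ≡⟨ ≡.cong (pow a) (≡.sym i+[1+k∸i]≡1+k) ⟩
    pow a (i ℕ.+ suc (k ∸ i))      ≈⟨ pow-+ a i (suc (k ∸ i)) ⟩
    pow a i * pow a (suc (k ∸ i))  ∎
    where
    i+[1+k∸i]≡1+k : i ℕ.+ suc (k ∸ i) ≡ suc k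
    i+[1+k∸i]≡1+k = ≡.trans (+-suc i (k ∸ i)) (≡.cong suc (m+[n∸m]≡n i≤k))

  module QBinomial (n : ℕ) (q : Carrier) (invQ : ℕ → Carrier)
                   (invQ-inverse : ∀ i → i ≤ n → qPoch q q i * invQ i ≈ 1#) where

    binom : ℕ → ℕ → Carrier
    binom = qBinom invQ q

    invQ-zero : invQ 0 ≈ 1#
    invQ-zero = trans (sym (*-identityˡ (invQ 0))) (invQ-inverse 0 z≤n)

    invQ-suc : ∀ k → suc k ≤ n → (1# - pow q (suc k)) * invQ (suc k) ≈ invQ k
    invQ-suc k 1+k≤n = *-inverse-unique
      (trans (sym (*-assoc _ _ _)) (invQ-inverse (suc k) 1+k≤n)) (invQ-inverse k (<⇒≤ 1+k≤n))

    invQ-suc-∸ : ∀ {i k} → i ≤ k → suc k ≤ n → (1# - pow q (suc (k ∸ i))) * invQ (suc k ∸ i) ≈ invQ (k ∸ i)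
    invQ-suc-∸ {i} {k} i≤k 1+k≤n =
      trans (*-congˡ (reflexive (≡.cong invQ (+-∸-assoc 1 i≤k))))
            (invQ-suc (k ∸ i) (≤-trans (s≤s (m∸n≤m k i)) 1+k≤n))

    qBinom-zero : ∀ {m} → m ≤ n → binom m 0 ≈ 1#
    qBinom-zero {m} m≤n = trans (*-congˡ (trans (*-congʳ invQ-zero) (*-identityˡ (invQ m)))) (invQ-inverse m m≤n)

    qBinom-diag : ∀ {m} → m ≤ n → binom m m ≈ 1#
    qBinom-diag {m} m≤n = trans (*-congˡ invQ[m∸m]≈1) (invQ-inverse m m≤n)
      where
      invQ[m∸m]≈1 : invQ m * invQ (m ∸ m) ≈ invQ m
      invQ[m∸m]≈1 = trans (*-congˡ (trans (reflexive (≡.cong invQ (n∸n≡0 m))) invQ-zero)) (*-identityʳ (invQ m))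

    qBinom-pascal : ∀ {i m} → i < m → suc m ≤ n →
      binom (suc m) (suc i) ≈ binom m i + pow q (suc i) * binom m (suc i)
    qBinom-pascal {i} {suc k} (s≤s i≤k) 2+k≤n = begin
      Q * (1# - pow q (suc (suc k))) * (invQ (suc i) * invQ (suc k ∸ i))
        ≈⟨ *-congʳ (*-congˡ (+-congˡ (-‿cong (pow-split q (s≤s i≤k))))) ⟩
      Q * (1# - a * e) * (invQ (suc i) * invQ (suc k ∸ i))
        ≈⟨ solve 5 (λ Q a e u v → Q :* (one :- a :* e) :* (u :* v)
                      := Q :* ((one :- a) :* u :* v) :+ a :* (Q :* (u :* ((one :- e) :* v))))
             refl Q a e (invQ (suc i)) (invQ (suc k ∸ i)) ⟩
      Q * ((1# - a) * invQ (suc i) * invQ (suc k ∸ i)) + a * (Q * (invQ (suc i) * ((1# - e) * invQ (suc k ∸ i))))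
        ≈⟨ +-cong (*-congˡ (*-congʳ (invQ-suc i (≤-trans (s≤s i≤k) (<⇒≤ 2+k≤n)))))
                  (*-congˡ (*-congˡ (*-congˡ (invQ-suc-∸ i≤k (<⇒≤ 2+k≤n))))) ⟩
      binom (suc k) i + a * binom (suc k) (suc i) ∎
      where
      Q a e : Carrier
      Q = qPoch q q (suc k)
      a = pow q (suc i)
      e = pow q (suc (k ∸ i))

    qBinom-absorption : ∀ {i k} → i ≤ k → suc k ≤ n →
      binom (suc k) i * (1# - pow q (suc (k ∸ i))) ≈ (1# - pow q (suc k)) * binom k i
    qBinom-absorption {i} {k} i≤k 1+k≤n = begin
      qPoch q q k * c * (invQ i * invQ (suc k ∸ i)) * (1# - e)
        ≈⟨ solve 5 (λ Q c u v e → Q :* c :* (u :* v) :* (one :- e) := c :* (Q :* (u :* ((one :- e) :* v))))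
             refl (qPoch q q k) c (invQ i) (invQ (suc k ∸ i)) e ⟩
      c * (qPoch q q k * (invQ i * ((1# - e) * invQ (suc k ∸ i))))
        ≈⟨ *-congˡ (*-congˡ (*-congˡ (invQ-suc-∸ i≤k 1+k≤n))) ⟩
      c * binom k i ∎
      where
      c e : Carrier
      c = 1# - pow q (suc k)
      e = pow q (suc (k ∸ i))

    alternatingTerm : Carrier → ℕ → ℕ → Carrier
    alternatingTerm x m i = binom m i * pow (- 1#) i * riseProd x q i

    sumTo-alternatingTerm : ∀ x {m} → m ≤ n → sumTo m (alternatingTerm x m) ≈ pow (- x) m
    sumTo-alternatingTerm x {zero}  _     = trans (*-identityʳ _) (trans (*-identityʳ _) (qBinom-zero z≤n))
    sumTo-alternatingTerm x {suc m} 1+m≤n = begin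
      sumTo (suc m) (alternatingTerm x (suc m))
        ≈⟨ sumTo-pascal m first step last ⟩
      sumTo m (λ i → shifted i + pow q i * alternatingTerm x m i)
        ≈⟨ sumTo-cong m (λ i _ → solve 5 (λ b s r x Q →
             b :* (:- one :* s) :* (r :* (x :+ Q)) :+ Q :* (b :* s :* r) := :- x :* (b :* s :* r))
             refl (binom m i) (pow (- 1#) i) (riseProd x q i) x (pow q i)) ⟩
      sumTo m (λ i → - x * alternatingTerm x m i)
        ≈⟨ *-distribˡ-sumTo m (- x) (alternatingTerm x m) ⟨
      - x * sumTo m (alternatingTerm x m)
        ≈⟨ *-congˡ (sumTo-alternatingTerm x (<⇒≤ 1+m≤n)) ⟩
      - x * pow (- x) m ∎
      where
      -- The boundary terms are treated apart since, by truncated subtraction,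
      -- qBinom invQ q m (m + 1) is not 0.
      shifted : ℕ → Carrier
      shifted i = binom m i * pow (- 1#) (suc i) * riseProd x q (suc i)
      first : alternatingTerm x (suc m) 0 ≈ pow q 0 * alternatingTerm x m 0
      first = trans (*-congʳ (*-congʳ (trans (qBinom-zero 1+m≤n) (sym (qBinom-zero (<⇒≤ 1+m≤n))))))
                    (sym (*-identityˡ _))
      step : ∀ i → i < m → alternatingTerm x (suc m) (suc i) ≈ shifted i + pow q (suc i) * alternatingTerm x m (suc i)
      step i i<m = trans (*-congʳ (*-congʳ (qBinom-pascal i<m 1+m≤n)))
        (solve 5 (λ b Q c s r → (b :+ Q :* c) :* s :* r := b :* s :* r :+ Q :* (c :* s :* r))
           refl (binom m i) (pow q (suc i)) (binom m (suc i)) (pow (- 1#) (suc i)) (riseProd x q (suc i)))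
      last : alternatingTerm x (suc m) (suc m) ≈ shifted m
      last = *-congʳ (*-congʳ (trans (qBinom-diag 1+m≤n) (sym (qBinom-diag (<⇒≤ 1+m≤n)))))

    module PartialFractions (t : Carrier) (invD : ℕ → Carrier)
        (invD-inverse : ∀ i → i ≤ n → (1# - t * pow q i) * invD i ≈ 1#) (x : Carrier) where

      term : ℕ → ℕ → Carrier
      term m i = binom m i * (- pow (- 1#) i) * riseProd x q i * (pow q i * invD i)

      leftSum : ℕ → Carrier
      leftSum m = sumTo m (term m)

      rightSum : ℕ → Carrier
      rightSum m = sumTo m (λ i → qPoch t q i * invQ i * pow (- (x * q)) i)

      term-recurrence : ∀ {i k} → i ≤ k → suc k ≤ n →
        (1# - t * pow q (suc k)) * term (suc k) i
          ≈ (1# - pow q (suc k)) * term k i + - pow q (suc k) * alternatingTerm x (suc k) i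
      term-recurrence {i} {k} i≤k 1+k≤n = begin
        (1# - t * pow q (suc k)) * (b * - s * ρ * (a * d))
          ≈⟨ *-congʳ (+-congˡ (-‿cong (*-congˡ split))) ⟩
        (1# - t * (a * e)) * (b * - s * ρ * (a * d))
          ≈⟨ solve 7 (λ t a e b s ρ d →
               (one :- t :* (a :* e)) :* (b :* :- s :* ρ :* (a :* d))
               := (b :* (one :- e)) :* (:- s :* ρ :* (a :* d)) :+ :- (a :* e) :* (b :* s :* ρ) :* ((one :- t :* a) :* d))
             refl t a e b s ρ d ⟩
        (b * (1# - e)) * (- s * ρ * (a * d)) + - (a * e) * (b * s * ρ) * ((1# - t * a) * d)
          ≈⟨ +-cong (*-congʳ (qBinom-absorption i≤k 1+k≤n))
                    (*-cong (*-congʳ (-‿cong (sym split))) (invD-inverse i (≤-trans i≤k (<⇒≤ 1+k≤n)))) ⟩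
        ((1# - pow q (suc k)) * binom k i) * (- s * ρ * (a * d)) + - pow q (suc k) * (b * s * ρ) * 1#
          ≈⟨ solve 7 (λ c bk s ρ a d y → c :* bk :* (:- s :* ρ :* (a :* d)) :+ y :* one
                                         := c :* (bk :* :- s :* ρ :* (a :* d)) :+ y)
               refl (1# - pow q (suc k)) (binom k i) s ρ a d (- pow q (suc k) * (b * s * ρ)) ⟩
        (1# - pow q (suc k)) * term k i + - pow q (suc k) * alternatingTerm x (suc k) i ∎
        where
        b s ρ a d e : Carrier
        b = binom (suc k) i
        s = pow (- 1#) i
        ρ = riseProd x q i
        a = pow q i
        d = invD i
        e = pow q (suc (k ∸ i))
        split : pow q (suc k) ≈ a * e
        split = pow-split q i≤k

      term-diag : ∀ {m} → m ≤ n → (1# - t * pow q m) * term m m ≈ - pow q m * alternatingTerm x m m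
      term-diag {m} m≤n = begin
        c * (b * - s * ρ * (a * d))
          ≈⟨ solve 6 (λ c b s ρ a d → c :* (b :* :- s :* ρ :* (a :* d)) := :- a :* (b :* s :* ρ) :* (c :* d))
               refl c b s ρ a d ⟩
        - a * (b * s * ρ) * (c * d)   ≈⟨ *-congˡ (invD-inverse m m≤n) ⟩
        - a * (b * s * ρ) * 1#        ≈⟨ *-identityʳ _ ⟩
        - a * (b * s * ρ)             ∎
        where
        c b s ρ a d : Carrier
        c = 1# - t * pow q m
        b = binom m m
        s = pow (- 1#) m
        ρ = riseProd x q m
        a = pow q m
        d = invD m

      leftSum-recurrence : ∀ k → suc k ≤ n →
        (1# - t * pow q (suc k)) * leftSum (suc k) ≈ (1# - pow q (suc k)) * leftSum k + - pow q (suc k) * pow (- x) (suc k)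
      leftSum-recurrence k 1+k≤n = begin
        c * leftSum m
          ≈⟨ *-distribˡ-sumTo m c (term m) ⟩
        sumTo k (λ i → c * term m i) + c * term m m
          ≈⟨ +-cong (sumTo-cong k (λ i i≤k → term-recurrence i≤k 1+k≤n)) (term-diag 1+k≤n) ⟩
        sumTo k (λ i → c′ * term k i + - Q * alternatingTerm x m i) + - Q * alternatingTerm x m m
          ≈⟨ +-congʳ (sumTo-linear k c′ (- Q) (term k) (alternatingTerm x m)) ⟩
        (c′ * leftSum k + - Q * sumTo k (alternatingTerm x m)) + - Q * alternatingTerm x m m
          ≈⟨ solve 4 (λ L Q S u → (L :+ Q :* S) :+ Q :* u := L :+ Q :* (S :+ u))
               refl (c′ * leftSum k) (- Q) (sumTo k (alternatingTerm x m)) (alternatingTerm x m m) ⟩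
        c′ * leftSum k + - Q * sumTo m (alternatingTerm x m)
          ≈⟨ +-congˡ (*-congˡ (sumTo-alternatingTerm x 1+k≤n)) ⟩
        c′ * leftSum k + - Q * pow (- x) m ∎
        where
        m : ℕ
        m = suc k
        Q c c′ : Carrier
        Q = pow q m
        c = 1# - t * Q
        c′ = 1# - Q

      qPoch-leftSum : ∀ m → m ≤ n → qPoch t q (suc m) * leftSum m ≈ - qPoch q q m * rightSum m
      qPoch-leftSum zero    0≤n = begin
        1# * c * (b * - 1# * 1# * (1# * d))
          ≈⟨ solve 3 (λ c b d → one :* c :* (b :* :- one :* one :* (one :* d)) := :- (b :* (c :* d))) refl c b d ⟩
        - (b * (c * d))
          ≈⟨ -‿cong (*-cong (trans (qBinom-zero 0≤n) (sym invQ-zero)) (invD-inverse 0 0≤n)) ⟩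
        - (invQ 0 * 1#)
          ≈⟨ solve 1 (λ u → :- (u :* one) := :- one :* (one :* u :* one)) refl (invQ 0) ⟩
        - 1# * (1# * invQ 0 * 1#) ∎
        where
        c b d : Carrier
        c = 1# - t * 1#
        b = binom 0 0
        d = invD 0
      qPoch-leftSum (suc k) 1+k≤n = begin
        P * c * leftSum m
          ≈⟨ *-assoc P c (leftSum m) ⟩
        P * (c * leftSum m)
          ≈⟨ *-congˡ (leftSum-recurrence k 1+k≤n) ⟩
        P * (c′ * leftSum k + - Q * pow (- x) m)
          ≈⟨ solve 5 (λ P c′ L Q z → P :* (c′ :* L :+ :- Q :* z) := c′ :* (P :* L) :+ :- (P :* (Q :* z)))
               refl P c′ (leftSum k) Q (pow (- x) m) ⟩
        c′ * (P * leftSum k) + - (P * (Q * pow (- x) m))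
          ≈⟨ +-cong (*-congˡ (qPoch-leftSum k (<⇒≤ 1+k≤n))) (-‿cong (*-congˡ (sym power))) ⟩
        c′ * (- qPoch q q k * rightSum k) + - (P * y)
          ≈⟨ +-congˡ (*-identityʳ _) ⟨
        c′ * (- qPoch q q k * rightSum k) + - (P * y) * 1#
          ≈⟨ +-congˡ (*-congˡ (invQ-inverse m 1+k≤n)) ⟨
        c′ * (- qPoch q q k * rightSum k) + - (P * y) * (qPoch q q k * c′ * invQ m)
          ≈⟨ solve 6 (λ c′ Qk S P y u → c′ :* (:- Qk :* S) :+ :- (P :* y) :* (Qk :* c′ :* u)
                                        := :- (Qk :* c′) :* (S :+ P :* u :* y))
               refl c′ (qPoch q q k) (rightSum k) P y (invQ m) ⟩
        - qPoch q q m * rightSum m ∎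
        where
        m : ℕ
        m = suc k
        P Q c c′ y : Carrier
        P = qPoch t q m
        Q = pow q m
        c = 1# - t * Q
        c′ = 1# - Q
        y = pow (- (x * q)) m
        power : y ≈ Q * pow (- x) m
        power = trans (pow-cong m (solve 2 (λ x q → :- (x :* q) := q :* :- x) refl x q)) (pow-distrib-* q (- x) m)

mainTheorem2 : ∀ {c ℓ : Level} (R : CommutativeRing c ℓ) →
    let open CommutativeRing R
        open QNotation R
    in (n : ℕ) (q x t : Carrier) (invQ invD : ℕ → Carrier) (invT : Carrier) →
       (∀ i → i ≤ n → qPoch q q i * invQ i ≈ 1#) →
       (∀ i → i ≤ n → (1# + - (t * pow q i)) * invD i ≈ 1#) →
       qPoch t q (suc n) * invT ≈ 1# →
       sumTo n (λ i → qBinom invQ q n i * (- pow (- 1#) i) * riseProd x q i * (pow q i * invD i))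
         ≈ - (qPoch q q n * invT) * sumTo n (λ i → qPoch t q i * invQ i * pow (- (x * q)) i)
mainTheorem2 R n q x t invQ invD invT invQ-inverse invD-inverse invT-inverse =
  trans (*-inverse-solve invT-inverse (qPoch-leftSum n ≤-refl))
        (solve 3 (λ u Q S → u :* (:- Q :* S) := :- (Q :* u) :* S) refl invT (qPoch q q n) (rightSum n))
  where
  open CommutativeRing R
  open QNotation R
  open QSeries R
  open IntegerCoefficientSolver R
  open QBinomial n q invQ invQ-inverse
  open PartialFractions t invD invD-inverse x
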